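{- Let $CG$ be a caterpillar graph on $n$ vertices. Then for every $r\geq 1$ the simplicial complex $\mathrm{Ind}_r(CG)$ is vertex decomposable.
   Context: A caterpillar graph is a tree in which every vertex is on a central path or is adjacent to a vertex of that path. For $r\ge1$, a subset $A\subseteq V(G)$ is $r$-independent if every connected component of the induced subgraph $G[A]$ has at most $r$ vertices; $\mathrm{Ind}_r(G)$ is the simplicial complex on $V(G)$ whose faces are the $r$-independent subsets. For a simplicial complex $\mathcal K$ and vertex $x$, $\mathrm{lk}_{\mathcal K}(x)=\{F\in\mathcal K: x\notin F,\ F\cup\{x\}\in\mathcal K\}$ and $\mathrm{del}_{\mathcal K}(x)=\{F\in\mathcal K: x\notin F\}$. $\mathcal K$ is vertex decomposable if either $\mathcal K$ is a simplex, or there is a vertex $x$ such that $\mathrm{lk}_{\mathcal K}(x)$ and $\mathrm{del}_{\mathcal K}(x)$ are vertex decomposable and every facet of $\mathrm{del}_{\mathcal K}(x)$ is a facet of $\mathcal K$. -}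

module Defs where

open import Data.Nat using (ℕ; _≤_)
open import Data.Fin using (Fin)
open import Data.Fin.Subset using (Subset; _∈_; _∉_; _⊆_; _∪_; ⁅_⁆)
open import Data.List using (List; []; _∷_; _++_; [_]; length)
open import Data.List.Relation.Unary.All using (All)
open import Data.List.Relation.Unary.Any using (Any)
open import Data.List.Relation.Unary.Unique.Propositional using (Unique)
open import Data.List.Membership.Propositional using () renaming (_∈_ to _∈ₗ_)
open import Data.Product using (Σ; _×_; ∃)
open import Data.Sum using (_⊎_)
open import Data.Unit using (⊤)
open import Data.Empty using (⊥)
open import Relation.Nullary using (¬_)
open import Relation.Binary.PropositionalEquality using (_≡_)
open import Level using (suc; zero)

record Graph (n : ℕ) : Set₁ where
  field
    Adj     : Fin n → Fin n → Set
    symm    : ∀ {u v} → Adj u v → Adj v u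
    irrefl  : ∀ {u} → ¬ Adj u u

open Graph public

data Walk {n : ℕ} (G : Graph n) (P : Fin n → Set) : Fin n → Fin n → Set where
  here  : ∀ {u} → P u → Walk G P u u
  there : ∀ {u w v} → P u → Adj G u w → Walk G P w v → Walk G P u v

data Chain {n : ℕ} (G : Graph n) : List (Fin n) → Set where
  []  : Chain G []
  [-] : ∀ {u} → Chain G (u ∷ [])
  _∷_ : ∀ {u w vs} → Adj G u w → Chain G (w ∷ vs) → Chain G (u ∷ w ∷ vs)

Connected : ∀ {n} → Graph n → Set
Connected G = ∀ u v → Walk G (λ _ → ⊤) u v

IsCycle : ∀ {n} → Graph n → List (Fin n) → Set
IsCycle G []       = ⊥
IsCycle G (u ∷ ws) =
  Unique (u ∷ ws) × (3 ≤ length (u ∷ ws)) × Chain G (u ∷ ws ++ [ u ])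

Acyclic : ∀ {n} → Graph n → Set
Acyclic G = ∀ vs → ¬ IsCycle G vs

IsTree : ∀ {n} → Graph n → Set
IsTree G = Connected G × Acyclic G

IsPath : ∀ {n} → Graph n → List (Fin n) → Set
IsPath G vs = Unique vs × Chain G vs

IsCaterpillar : ∀ {n} → Graph n → Set
IsCaterpillar {n} G =
  IsTree G ×
  Σ (List (Fin n)) λ p → IsPath G p ×
    (∀ v → v ∈ₗ p ⊎ Any (λ w → Adj G v w) p)

Complex : ℕ → Set₁
Complex n = Subset n → Set

-- r-independence: every connected component of G[A] has at most r vertices,
-- i.e. for every v ∈ A, any list of distinct vertices reachable from v
-- inside G[A] has length at most r.
RIndependent : ∀ {n} → ℕ → Graph n → Subset n → Set
RIndependent {n} r G A =
  ∀ v → v ∈ A → ∀ (xs : List (Fin n)) → Unique xs →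
    All (λ w → Walk G (λ x → x ∈ A) v w) xs → length xs ≤ r

Ind : ∀ {n} → ℕ → Graph n → Complex n
Ind r G A = RIndependent r G A

lk : ∀ {n} → Complex n → Fin n → Complex n
lk K x F = x ∉ F × K (F ∪ ⁅ x ⁆)

del : ∀ {n} → Complex n → Fin n → Complex n
del K x F = x ∉ F × K F

IsFacet : ∀ {n} → Complex n → Subset n → Set
IsFacet K F = K F × (∀ G → K G → F ⊆ G → G ⊆ F)

IsSimplex : ∀ {n} → Complex n → Set
IsSimplex {n} K = Σ (Subset n) λ F → ∀ G → (K G → G ⊆ F) × (G ⊆ F → K G)

data VertexDecomposable {n : ℕ} : Complex n → Set₁ where
  simplex : ∀ {K} → IsSimplex K → VertexDecomposable K
  shed    : ∀ {K} (x : Fin n) →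
            K ⁅ x ⁆ →
            VertexDecomposable (lk K x) →
            VertexDecomposable (del K x) →
            (∀ F → IsFacet (del K x) F → IsFacet K F) →
            VertexDecomposable K

module Submission where

-- Number the vertices of the central path 0, 1, …, len − 1 and give every other vertex the position
-- of its neighbour on the path; acyclicity makes that neighbour unique and rules out chords of the
-- path and edges between two vertices off it. Hence, for r ≥ 1, a set A is r-independent iff for
-- every run [a, j] of consecutive positions whose path vertices all lie in A, at most r vertices of
-- A have their position in [a, j].
--
-- For disjoint T, V with T r-independent, let K(T, V) (Restricted T V below) be the complex of all
-- F ⊆ V with F ∪ T r-independent. Then Ind_r = K(∅, everything), and the link and deletion of x ∈ V
-- in K(T, V) are K(T ∪ {x}, V − x) and K(T, V − x), unless T ∪ {x} is not r-independent, in which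
-- case K(T, V) = K(T, V − x); so we may induct on |V|. If T ∪ V is r-independent, K(T, V) is
-- a simplex. Otherwise take a violated run [a, j] of T ∪ V with j least and then a least, and let x
-- be the rightmost path vertex of V in it, or, if there is none, any vertex of V positioned in
-- [a, j]. By the minimality of the run, or by moving a leaf to the place of x, x can be exchanged
-- for any other vertex of V positioned in [a, j]. So a facet of the deletion that remained a face
-- after adding x would contain every vertex of T ∪ V positioned in [a, j], more than r of them:
-- x is a shedding vertex.

open import Defs
open import Algebra.Bundles using (CommutativeMonoid)
open import Data.Empty using (⊥; ⊥-elim)
open import Data.Fin using (Fin; zero; suc; toℕ; _≟_)
import Data.Fin.Properties as Fin
open import Data.Fin.Properties using (toℕ<n)
open import Data.Fin.Subset using (Subset; inside; outside; _∈_; _∉_; _⊆_; _∪_; _∩_; _-_; ⁅_⁆; ∣_∣)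
  renaming (⊥ to ∅; ⊤ to full)
open import Data.Fin.Subset.Properties
open import Data.List using (List; []; _∷_; _++_; length; map)
open import Data.List.Properties using (length-map)
open import Data.List.Membership.Propositional using () renaming (_∈_ to _∈ₗ_; _∉_ to _∉ₗ_)
open import Data.List.Relation.Unary.All using (All; []; _∷_)
import Data.List.Relation.Unary.All as All
import Data.List.Relation.Unary.All.Properties as All
open import Data.List.Relation.Unary.AllPairs using ([]; _∷_)
open import Data.List.Relation.Unary.Any as Any using (Any; here; there)
open import Data.List.Relation.Unary.Unique.Propositional using (Unique)
import Data.List.Relation.Unary.Unique.Propositional.Properties as Unique
open import Data.Nat using (ℕ; zero; suc; _+_; _≤_; _<_; _≥_; z≤n; s≤s; _≤?_; _<?_; _⊓_; _⊔_)
open import Data.Nat.Induction using (<-wellFounded)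
open import Data.Nat.Properties hiding (_≟_)
open import Data.Product using (Σ; _×_; _,_; proj₁; proj₂; ∃-syntax)
import Data.Product
open import Data.Sum using (_⊎_; inj₁; inj₂; [_,_]′)
import Data.Sum
open import Data.Vec using ([]; _∷_; here; there; tabulate)
open import Data.Vec.Properties using (lookup∘tabulate; []=⇒lookup; lookup⇒[]=)
open import Function using (_∘_)
open import Induction.WellFounded using (Acc; acc)
open import Relation.Binary.Definitions using (tri<; tri≈; tri>)
open import Relation.Binary.PropositionalEquality using (_≡_; _≢_; refl; sym; trans; cong; subst; subst₂)
open import Relation.Nullary using (¬_; Dec; yes; no; does; _×-dec_; _→-dec_)
open import Relation.Nullary.Decidable using (dec-true; map′)
open import Relation.Unary using (Decidable; _≐_)

module _ {P : ℕ → Set} (P? : Decidable P) where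

  least< : ∀ b → (∀ {m} → m < b → ¬ P m) ⊎ ∃[ m ] (m < b × P m × ∀ {k} → k < m → ¬ P k)
  least< zero = inj₁ λ ()
  least< (suc b) with least< b
  ... | inj₂ (m , m<b , pm , below) = inj₂ (m , m≤n⇒m≤1+n m<b , pm , below)
  ... | inj₁ none with P? b
  ...   | yes pb = inj₂ (b , ≤-refl , pb , none)
  ...   | no ¬pb = inj₁ λ { (s≤s m≤b) → [ none , (λ { refl → ¬pb }) ]′ (m≤n⇒m<n∨m≡n m≤b) }

  greatest< : ∀ b → (∀ {m} → m < b → ¬ P m) ⊎ ∃[ m ] (m < b × P m × ∀ {k} → m < k → k < b → ¬ P k)
  greatest< zero = inj₁ λ ()
  greatest< (suc b) with P? b
  ... | yes pb = inj₂ (b , ≤-refl , pb , λ b<k k<1+b _ → <⇒≱ b<k (≤-pred k<1+b))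
  ... | no ¬pb with greatest< b
  ...   | inj₁ none = inj₁ λ { (s≤s m≤b) → [ none , (λ { refl → ¬pb }) ]′ (m≤n⇒m<n∨m≡n m≤b) }
  ...   | inj₂ (m , m<b , pm , above) =
    inj₂ (m , m≤n⇒m≤1+n m<b , pm , λ { m<k (s≤s k≤b) → [ above m<k , (λ { refl → ¬pb }) ]′ (m≤n⇒m<n∨m≡n k≤b) })

module _ {n : ℕ} {P : Fin n → Set} where

  subsetOf : Decidable P → Subset n
  subsetOf P? = tabulate (does ∘ P?)

  ∈subsetOf⁺ : ∀ (P? : Decidable P) {v} → P v → v ∈ subsetOf P?
  ∈subsetOf⁺ P? {v} pv = lookup⇒[]= v _ (trans (lookup∘tabulate _ v) (dec-true (P? v) pv))

  ∈subsetOf⁻ : ∀ (P? : Decidable P) {v} → v ∈ subsetOf P? → P v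
  ∈subsetOf⁻ P? {v} v∈ with P? v | trans (sym (lookup∘tabulate (does ∘ P?) v)) ([]=⇒lookup v∈)
  ... | yes pv | _ = pv
  ... | no _ | ()

x∈p∪⁅y⁆⁻ : ∀ {n} (p : Subset n) {x y} → x ∈ p ∪ ⁅ y ⁆ → x ∈ p ⊎ x ≡ y
x∈p∪⁅y⁆⁻ p {y = y} x∈ = Data.Sum.map₂ (x∈⁅y⁆⇒x≡y y) (x∈p∪q⁻ p ⁅ y ⁆ x∈)

∩-mono : ∀ {n} {p q r s : Subset n} → p ⊆ q → r ⊆ s → p ∩ r ⊆ q ∩ s
∩-mono {p = p} {r = r} p⊆q r⊆s x∈ = let (x∈p , x∈r) = x∈p∩q⁻ p r x∈ in x∈p∩q⁺ (p⊆q x∈p , r⊆s x∈r)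

∪-lub : ∀ {n} {p q r : Subset n} → p ⊆ r → q ⊆ r → p ∪ q ⊆ r
∪-lub {p = p} {q} p⊆r q⊆r x∈ with x∈p∪q⁻ p q x∈
... | inj₁ x∈p = p⊆r x∈p
... | inj₂ x∈q = q⊆r x∈q

⁅x⁆⊆p : ∀ {n} {p : Subset n} {x} → x ∈ p → ⁅ x ⁆ ⊆ p
⁅x⁆⊆p {p = p} {x} x∈p y∈ = subst (_∈ p) (sym (x∈⁅y⁆⇒x≡y x y∈)) x∈p

x∉p∪q : ∀ {n} {p q : Subset n} {x} → x ∉ p → x ∉ q → x ∉ p ∪ q
x∉p∪q {p = p} {q} x∉p x∉q x∈ with x∈p∪q⁻ p q x∈
... | inj₁ x∈p = x∉p x∈p
... | inj₂ x∈q = x∉q x∈q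

x∉p-x : ∀ {n} (p : Subset n) x → x ∉ p - x
x∉p-x (s ∷ p) zero ()
x∉p-x (s ∷ p) (suc x) (there x∈) = x∉p-x p x x∈

⊆-minus⁺ : ∀ {n} {p q : Subset n} {x} → p ⊆ q → x ∉ p → p ⊆ q - x
⊆-minus⁺ p⊆q x∉p y∈p = x∈p∧x≢y⇒x∈p-y (p⊆q y∈p) λ { refl → x∉p y∈p }

⊆-minus⁻ : ∀ {n} {p q : Subset n} {x} → p ⊆ q - x → p ⊆ q × x ∉ p
⊆-minus⁻ {q = q} {x} p⊆q-x = (λ y∈p → p─q⊆p q ⁅ x ⁆ (p⊆q-x y∈p)) , λ x∈p → x∉p-x q x (p⊆q-x x∈p)

∣p∪⁅x⁆∣≤1+∣p∣ : ∀ {n} (p : Subset n) x → ∣ p ∪ ⁅ x ⁆ ∣ ≤ suc ∣ p ∣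
∣p∪⁅x⁆∣≤1+∣p∣ (inside ∷ p) zero = s≤s (m≤n⇒m≤1+n (≤-reflexive (cong ∣_∣ (∪-identityʳ p))))
∣p∪⁅x⁆∣≤1+∣p∣ (outside ∷ p) zero = s≤s (≤-reflexive (cong ∣_∣ (∪-identityʳ p)))
∣p∪⁅x⁆∣≤1+∣p∣ (inside ∷ p) (suc x) = s≤s (∣p∪⁅x⁆∣≤1+∣p∣ p x)
∣p∪⁅x⁆∣≤1+∣p∣ (outside ∷ p) (suc x) = ∣p∪⁅x⁆∣≤1+∣p∣ p x

x∉p⇒∣p∣<∣p∪⁅x⁆∣ : ∀ {n} {p : Subset n} {x} → x ∉ p → ∣ p ∣ < ∣ p ∪ ⁅ x ⁆ ∣
x∉p⇒∣p∣<∣p∪⁅x⁆∣ {p = p} {x} x∉p =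
  ≤-<-trans (p⊆q⇒∣p∣≤∣q∣ (⊆-minus⁺ (p⊆p∪q ⁅ x ⁆) x∉p)) (x∈p⇒∣p-x∣<∣p∣ (q⊆p∪q p _ (x∈⁅x⁆ x)))

∣p∪⁅x⁆∩q∣≤1+∣p∩q∣ : ∀ {n} (p q : Subset n) x → ∣ (p ∪ ⁅ x ⁆) ∩ q ∣ ≤ suc ∣ p ∩ q ∣
∣p∪⁅x⁆∩q∣≤1+∣p∩q∣ p q x = ≤-trans (p⊆q⇒∣p∣≤∣q∣ sub) (∣p∪⁅x⁆∣≤1+∣p∣ (p ∩ q) x)
  where
  sub : (p ∪ ⁅ x ⁆) ∩ q ⊆ (p ∩ q) ∪ ⁅ x ⁆
  sub y∈ with x∈p∩q⁻ (p ∪ ⁅ x ⁆) q y∈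
  ... | y∈p∪x , y∈q with x∈p∪⁅y⁆⁻ p y∈p∪x
  ...   | inj₁ y∈p = p⊆p∪q _ (x∈p∩q⁺ (y∈p , y∈q))
  ...   | inj₂ refl = q⊆p∪q _ _ (x∈⁅x⁆ x)

x∉p∧x∈q⇒∣p∩q∣<∣p∪⁅x⁆∩q∣ : ∀ {n} {p q : Subset n} {x} → x ∉ p → x ∈ q → ∣ p ∩ q ∣ < ∣ (p ∪ ⁅ x ⁆) ∩ q ∣
x∉p∧x∈q⇒∣p∩q∣<∣p∪⁅x⁆∩q∣ {p = p} {q} {x} x∉p x∈q =
  ≤-trans (x∉p⇒∣p∣<∣p∪⁅x⁆∣ (x∉p ∘ proj₁ ∘ x∈p∩q⁻ p q)) (p⊆q⇒∣p∣≤∣q∣ sup)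
  where
  sup : (p ∩ q) ∪ ⁅ x ⁆ ⊆ (p ∪ ⁅ x ⁆) ∩ q
  sup y∈ with x∈p∪⁅y⁆⁻ (p ∩ q) y∈
  ... | inj₁ y∈p∩q = ∩-mono (p⊆p∪q _) ⊆-refl y∈p∩q
  ... | inj₂ refl = x∈p∩q⁺ (q⊆p∪q _ _ (x∈⁅x⁆ x) , x∈q)

unique⇒length≤∣p∣ : ∀ {n} {p : Subset n} {xs} → Unique xs → All (_∈ p) xs → length xs ≤ ∣ p ∣
unique⇒length≤∣p∣ [] [] = z≤n
unique⇒length≤∣p∣ (x∉xs ∷ u) (x∈p ∷ xs⊆p) =
  ≤-trans (s≤s (unique⇒length≤∣p∣ u (All.zipWith (λ (x≢y , y∈p) → x∈p∧x≢y⇒x∈p-y y∈p (x≢y ∘ sym)) (x∉xs , xs⊆p))))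
          (x∈p⇒∣p-x∣<∣p∣ x∈p)

enumerate : ∀ {n} (p : Subset n) → Σ (List (Fin n)) λ xs → Unique xs × All (_∈ p) xs × length xs ≡ ∣ p ∣
enumerate [] = [] , [] , [] , refl
enumerate (s ∷ p) with enumerate p
... | xs , u , xs⊆p , l with s
...   | inside = zero ∷ map suc xs , All.map⁺ (All.universal (λ _ ()) xs) ∷ Unique.map⁺ Fin.suc-injective u
                 , here ∷ All.map⁺ (All.map there xs⊆p) , cong suc (trans (length-map suc xs) l)
...   | outside = map suc xs , Unique.map⁺ Fin.suc-injective u , All.map⁺ (All.map there xs⊆p) , trans (length-map suc xs) l

module _ {n : ℕ} {K L : Complex n} (K≐L : K ≐ L) where

  private
    K⊆L = proj₁ K≐L
    L⊆K = proj₂ K≐L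

  lk-resp : ∀ x → lk K x ≐ lk L x
  lk-resp x = (λ (x∉F , k) → x∉F , K⊆L k) , (λ (x∉F , l) → x∉F , L⊆K l)

  del-resp : ∀ x → del K x ≐ del L x
  del-resp x = (λ (x∉F , k) → x∉F , K⊆L k) , (λ (x∉F , l) → x∉F , L⊆K l)

  IsFacet-resp : ∀ F → IsFacet K F → IsFacet L F
  IsFacet-resp F (kF , maximal) = K⊆L kF , λ G lG F⊆G → maximal G (L⊆K lG) F⊆G

VertexDecomposable-resp : ∀ {n} {K L : Complex n} → K ≐ L → VertexDecomposable K → VertexDecomposable L
VertexDecomposable-resp (K⊆L , L⊆K) (simplex (F , faces)) =
  simplex (F , λ G → (λ lG → proj₁ (faces G) (L⊆K lG)) , (λ G⊆F → K⊆L (proj₂ (faces G) G⊆F)))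
VertexDecomposable-resp K≐L@(K⊆L , _) (shed x kx vd-lk vd-del facets) =
  shed x (K⊆L kx) (VertexDecomposable-resp (lk-resp K≐L x) vd-lk) (VertexDecomposable-resp (del-resp K≐L x) vd-del)
    λ F → IsFacet-resp K≐L F ∘ facets F ∘ IsFacet-resp (Data.Product.swap (del-resp K≐L x)) F

module _ {n : ℕ} {G : Graph n} {P : Fin n → Set} where

  walk-start : ∀ {s t} → Walk G P s t → P s
  walk-start (here ps) = ps
  walk-start (there ps _ _) = ps

  walk-end : ∀ {s t} → Walk G P s t → P t
  walk-end (here pt) = pt
  walk-end (there _ _ w) = walk-end w

  walk-snoc : ∀ {s t u} → Walk G P s t → Adj G t u → P u → Walk G P s u
  walk-snoc (here pt) t~u pu = there pt t~u (here pu)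
  walk-snoc (there ps s~w w) t~u pu = there ps s~w (walk-snoc w t~u pu)

  walk-invariant : (R : Fin n → Set) → (∀ {u w} → P u → R u → Adj G u w → P w → R w) →
                   ∀ {s t} → Walk G P s t → R s → R t
  walk-invariant R step (here _) rs = rs
  walk-invariant R step (there ps s~w w) rs = walk-invariant R step w (step ps rs s~w (walk-start w))

-- The spine of a caterpillar

-- spine m is the m-th vertex of the path (junk for m ≥ len); pos v is the position of v if v is on
-- the path, and that of its unique path neighbour otherwise.
record Spine {n : ℕ} (G : Graph n) : Set where
  field
    len       : ℕ
    spine     : ℕ → Fin n
    pos       : Fin n → ℕ
    pos<len   : ∀ v → pos v < len
    pos-spine : ∀ {m} → m < len → pos (spine m) ≡ m
    adj-next  : ∀ {m} → suc m < len → Adj G (spine m) (spine (suc m))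
    adj-foot  : ∀ {v} → spine (pos v) ≢ v → Adj G v (spine (pos v))
    leaf-adj  : ∀ {v w} → spine (pos v) ≢ v → Adj G v w → w ≡ spine (pos v)
    spine-adj : ∀ {u w} → spine (pos u) ≡ u → spine (pos w) ≡ w → Adj G u w →
                suc (pos u) ≡ pos w ⊎ suc (pos w) ≡ pos u

module _ {n : ℕ} (default : Fin n) where

  nth : List (Fin n) → ℕ → Fin n
  nth [] _ = default
  nth (x ∷ xs) zero = x
  nth (x ∷ xs) (suc m) = nth xs m

  nth-∈ : ∀ xs {m} → m < length xs → nth xs m ∈ₗ xs
  nth-∈ (x ∷ xs) {zero} _ = here refl
  nth-∈ (x ∷ xs) {suc m} (s≤s m<len) = there (nth-∈ xs m<len)

  nth-index : ∀ {P : Fin n → Set} {xs} (p : Any P xs) → P (nth xs (toℕ (Any.index p)))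
  nth-index (here px) = px
  nth-index (there p) = nth-index p

  All-nth : ∀ {P : Fin n → Set} {xs} → All P xs → ∀ {m} → m < length xs → P (nth xs m)
  All-nth (p ∷ _) {zero} _ = p
  All-nth (_ ∷ ps) {suc m} (s≤s m<) = All-nth ps m<

  nth-injective : ∀ {xs} → Unique xs → ∀ {i l} → i < length xs → l < length xs → nth xs i ≡ nth xs l → i ≡ l
  nth-injective {x ∷ xs} _ {zero} {zero} _ _ _ = refl
  nth-injective {x ∷ xs} (x∉ ∷ _) {zero} {suc l} _ (s≤s l<) e = ⊥-elim (All-nth x∉ l< e)
  nth-injective {x ∷ xs} (x∉ ∷ _) {suc i} {zero} (s≤s i<) _ e = ⊥-elim (All-nth x∉ i< (sym e))
  nth-injective {x ∷ xs} (_ ∷ u) {suc i} {suc l} (s≤s i<) (s≤s l<) e = cong suc (nth-injective u i< l< e)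

  nth-Chain : ∀ {G : Graph n} {xs} → Chain G xs → ∀ {m} → suc m < length xs → Adj G (nth xs m) (nth xs (suc m))
  nth-Chain (a ∷ _) {zero} _ = a
  nth-Chain (_ ∷ c) {suc m} (s≤s lt) = nth-Chain c lt
  nth-Chain [-] {m} (s≤s ())

module CaterpillarSpine {n : ℕ} (default : Fin n) {G : Graph n} (acyclic : Acyclic G)
                        {p : List (Fin n)} (unique : Unique p) (chain : Chain G p)
                        (cover : ∀ v → v ∈ₗ p ⊎ Any (Adj G v) p) where

  at : ℕ → Fin n
  at = nth default p

  spineFrom : ℕ → ℕ → List (Fin n)
  spineFrom j zero = []
  spineFrom j (suc e) = at j ∷ spineFrom (suc j) e

  segment : ℕ → ℕ → List (Fin n)
  segment i e = at i ∷ spineFrom (suc i) e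

  spineFrom-All : ∀ {P : Fin n → Set} j e → (∀ {l} → j ≤ l → l < j + e → P (at l)) → All P (spineFrom j e)
  spineFrom-All j zero _ = []
  spineFrom-All j (suc e) h =
    h ≤-refl (subst (j <_) (sym (+-suc j e)) (s≤s (m≤m+n j e)))
    ∷ spineFrom-All (suc j) e λ {l} j<l l< → h (<⇒≤ j<l) (subst (l <_) (sym (+-suc j e)) l<)

  segment-All : ∀ {P : Fin n → Set} i e → (∀ {l} → i ≤ l → l ≤ i + e → P (at l)) → All P (segment i e)
  segment-All i e h = h ≤-refl (m≤m+n i e) ∷ spineFrom-All (suc i) e λ i<l l< → h (<⇒≤ i<l) (≤-pred l<)

  segment-∉ : ∀ {v} → v ∉ₗ p → ∀ i e → i + e < length p → All (v ≢_) (segment i e)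
  segment-∉ v∉p i e lt = segment-All i e λ _ l≤ v≡ → v∉p (subst (_∈ₗ p) (sym v≡) (nth-∈ default p (≤-<-trans l≤ lt)))

  spineFrom-Unique : ∀ j e → j + e ≤ length p → Unique (spineFrom j e)
  spineFrom-Unique j zero _ = []
  spineFrom-Unique j (suc e) le =
    spineFrom-All (suc j) e (λ j<l l< ≡l → <-irrefl (nth-injective default unique j<len (<-≤-trans l< le′) ≡l) j<l)
    ∷ spineFrom-Unique (suc j) e le′
    where
    le′ : suc j + e ≤ length p
    le′ = subst (_≤ length p) (+-suc j e) le
    j<len : j < length p
    j<len = <-≤-trans (s≤s (m≤m+n j e)) le′

  segment-Unique : ∀ i e → i + e < length p → Unique (segment i e)
  segment-Unique i e lt = spineFrom-Unique i (suc e) (subst (_≤ length p) (sym (+-suc i e)) lt)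

  segment-Chain : ∀ i e {ys} → i + e < length p → Chain G (at (i + e) ∷ ys) → Chain G (segment i e ++ ys)
  segment-Chain i zero {ys} _ c = subst (λ k → Chain G (at k ∷ ys)) (+-identityʳ i) c
  segment-Chain i (suc e) {ys} lt c =
    nth-Chain default chain (≤-trans (s≤s (s≤s (m≤m+n i e))) (subst (_< length p) (+-suc i e) lt))
    ∷ segment-Chain (suc i) e (subst (_< length p) (+-suc i e) lt) (subst (λ k → Chain G (at k ∷ ys)) (+-suc i e) c)

  chord⇒successor : ∀ {i l} → i < l → l < length p → Adj G (at l) (at i) → suc i ≡ l
  chord⇒successor {i} i<l l< l~i with m≤n⇒∃[o]m+o≡n i<l
  ... | zero , 1+i≡l = trans (sym (+-identityʳ (suc i))) 1+i≡l
  ... | suc o , ≡l = ⊥-elim (no-long-chord (subst (_< length p) (sym l≡) l<) (subst (λ k → Adj G (at k) (at i)) (sym l≡) l~i))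
    where
    l≡ = trans (+-suc i (suc o)) ≡l
    no-long-chord : ∀ {e} → i + suc (suc e) < length p → ¬ Adj G (at (i + suc (suc e))) (at i)
    no-long-chord lt l~i =
      acyclic (segment i _) (segment-Unique i _ lt , s≤s (s≤s (s≤s z≤n)) , segment-Chain i _ lt (l~i ∷ [-]))

  at-adjacent : ∀ {i l} → i < length p → l < length p → Adj G (at i) (at l) → suc i ≡ l ⊎ suc l ≡ i
  at-adjacent {i} {l} i< l< i~l with <-cmp i l
  ... | tri≈ _ refl _ = ⊥-elim (irrefl G i~l)
  ... | tri< i<l _ _ = inj₁ (chord⇒successor i<l l< (symm G i~l))
  ... | tri> _ _ l<i = inj₂ (chord⇒successor l<i i< i~l)

  feet-equal : ∀ {v i l} → v ∉ₗ p → i ≤ l → l < length p → Adj G v (at i) → Adj G v (at l) → i ≡ l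
  feet-equal {v} {i} v∉p i≤l l< v~i v~l with m≤n⇒∃[o]m+o≡n i≤l
  ... | zero , ≡l = trans (sym (+-identityʳ i)) ≡l
  ... | suc o , refl = ⊥-elim (acyclic (v ∷ segment i _)
      (segment-∉ v∉p i _ l< ∷ segment-Unique i _ l< , s≤s (s≤s (s≤s z≤n)) , v~i ∷ segment-Chain i _ l< (symm G v~l ∷ [-])))

  no-leaf-edge : ∀ {u v i l} → u ∉ₗ p → v ∉ₗ p → Adj G u v → i ≤ l → l < length p → Adj G u (at i) → ¬ Adj G v (at l)
  no-leaf-edge {u} {v} {i} u∉p v∉p u~v i≤l l< u~i v~l with m≤n⇒∃[o]m+o≡n i≤l
  ... | o , refl =
    acyclic (v ∷ u ∷ segment i _)
      ( ((λ v≡u → irrefl G (subst (Adj G u) v≡u u~v)) ∷ segment-∉ v∉p i _ l<) ∷ segment-∉ u∉p i _ l< ∷ segment-Unique i _ l<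
      , s≤s (s≤s (s≤s z≤n))
      , symm G u~v ∷ u~i ∷ segment-Chain i _ l< (symm G v~l ∷ [-]))

  mem? : ∀ v → Dec (v ∈ₗ p)
  mem? v = Any.any? (v ≟_) p

  foot : ∀ {v} → v ∉ₗ p → Any (Adj G v) p
  foot {v} v∉p with cover v
  ... | inj₁ v∈p = ⊥-elim (v∉p v∈p)
  ... | inj₂ adj = adj

  position : ∀ {v} → Dec (v ∈ₗ p) → ℕ
  position (yes v∈p) = toℕ (Any.index v∈p)
  position (no v∉p) = toℕ (Any.index (foot v∉p))

  pos : Fin n → ℕ
  pos v = position (mem? v)

  pos<len : ∀ v → pos v < length p
  pos<len v with mem? v
  ... | yes v∈p = toℕ<n (Any.index v∈p)
  ... | no v∉p = toℕ<n (Any.index (foot v∉p))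

  at-pos : ∀ {v} → v ∈ₗ p → at (pos v) ≡ v
  at-pos {v} v∈p with mem? v
  ... | yes v∈p′ = sym (nth-index default v∈p′)
  ... | no v∉p = ⊥-elim (v∉p v∈p)

  pos-at : ∀ {m} → m < length p → pos (at m) ≡ m
  pos-at {m} m< = nth-injective default unique (pos<len (at m)) m< (at-pos (nth-∈ default p m<))

  off-spine : ∀ {v} → at (pos v) ≢ v → v ∉ₗ p
  off-spine leaf v∈p = leaf (at-pos v∈p)

  adj-foot : ∀ {v} → at (pos v) ≢ v → Adj G v (at (pos v))
  adj-foot {v} leaf with mem? v
  ... | yes v∈p = ⊥-elim (leaf (sym (nth-index default v∈p)))
  ... | no v∉p = nth-index default (foot v∉p)

  leaf-adj : ∀ {v w} → at (pos v) ≢ v → Adj G v w → w ≡ at (pos v)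
  leaf-adj {v} {w} leaf v~w with mem? w
  ... | no w∉p = ⊥-elim (lemma (≤-total (pos v) (pos w)))
    where
    w-leaf : at (pos w) ≢ w
    w-leaf = λ e → w∉p (subst (_∈ₗ p) e (nth-∈ default p (pos<len w)))
    lemma : pos v ≤ pos w ⊎ pos w ≤ pos v → ⊥
    lemma (inj₁ v≤w) = no-leaf-edge (off-spine leaf) w∉p v~w v≤w (pos<len w) (adj-foot leaf) (adj-foot w-leaf)
    lemma (inj₂ w≤v) = no-leaf-edge w∉p (off-spine leaf) (symm G v~w) w≤v (pos<len v) (adj-foot w-leaf) (adj-foot leaf)
  ... | yes w∈p = trans (sym (at-pos w∈p)) (cong at (sym (lemma (≤-total (pos v) (pos w)))))
    where
    v~w′ : Adj G v (at (pos w))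
    v~w′ = subst (Adj G v) (sym (at-pos w∈p)) v~w
    lemma : pos v ≤ pos w ⊎ pos w ≤ pos v → pos v ≡ pos w
    lemma (inj₁ v≤w) = feet-equal (off-spine leaf) v≤w (pos<len w) (adj-foot leaf) v~w′
    lemma (inj₂ w≤v) = sym (feet-equal (off-spine leaf) w≤v (pos<len v) v~w′ (adj-foot leaf))

  spine-structure : Spine G
  spine-structure = record
    { len = length p ; spine = at ; pos = pos ; pos<len = pos<len ; pos-spine = pos-at
    ; adj-next = nth-Chain default chain ; adj-foot = adj-foot ; leaf-adj = leaf-adj
    ; spine-adj = λ {u} {w} at-u at-w u~w → at-adjacent (pos<len u) (pos<len w) (subst₂ (Adj G) (sym at-u) (sym at-w) u~w) }

caterpillar-spine : ∀ {n} {G : Graph n} → Fin n → IsCaterpillar G → Spine G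
caterpillar-spine default ((_ , acyclic) , p , (unique , chain) , cover) =
  CaterpillarSpine.spine-structure default acyclic unique chain cover

-- r-independence along a spine

module SpineRuns {n : ℕ} {G : Graph n} (S : Spine G) (r : ℕ) where
  open Spine S

  inBox? : ∀ a j v → Dec (a ≤ pos v × pos v ≤ j)
  inBox? a j v = a ≤? pos v ×-dec pos v ≤? j

  -- Opaque, so that unification treats Box a j as rigid.
  opaque
    Box : ℕ → ℕ → Subset n
    Box a j = subsetOf (inBox? a j)

    ∈Box⁺ : ∀ {a j v} → a ≤ pos v → pos v ≤ j → v ∈ Box a j
    ∈Box⁺ {a} {j} a≤v v≤j = ∈subsetOf⁺ (inBox? a j) (a≤v , v≤j)

    ∈Box⁻ : ∀ {a j v} → v ∈ Box a j → a ≤ pos v × pos v ≤ j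
    ∈Box⁻ {a} {j} = ∈subsetOf⁻ (inBox? a j)

  spine∈Box : ∀ {a j m} → m < len → a ≤ m → m ≤ j → spine m ∈ Box a j
  spine∈Box m<len a≤m m≤j = ∈Box⁺ (subst (_ ≤_) (sym (pos-spine m<len)) a≤m) (subst (_≤ _) (sym (pos-spine m<len)) m≤j)

  SpineIn : Subset n → ℕ → Set
  SpineIn A m = m < len × spine m ∈ A

  spineIn? : ∀ A m → Dec (SpineIn A m)
  spineIn? A m = m <? len ×-dec spine m ∈? A

  Run : Subset n → ℕ → ℕ → Set
  Run A a j = ∀ {m} → a ≤ m → m ≤ j → SpineIn A m

  RunBounded : Subset n → Set
  RunBounded A = ∀ {a j} → a ≤ j → Run A a j → ∣ A ∩ Box a j ∣ ≤ r

  run? : ∀ A a j → Dec (Run A a j)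
  run? A a j = map′ (λ h {m} a≤m m≤j → h {m} (s≤s m≤j) a≤m) (λ h {m} m<1+j a≤m → h {m} a≤m (≤-pred m<1+j))
                    (allUpTo? (λ m → a ≤? m →-dec spineIn? A m) (suc j))

  Run-single : ∀ {A m} → SpineIn A m → Run A m m
  Run-single inA m≤k k≤m = subst (SpineIn _) (≤-antisym m≤k k≤m) inA

  Run-join : ∀ {A a m k j} → k ≤ suc m → Run A a m → Run A k j → Run A a j
  Run-join {m = m} k≤1+m left right {i} a≤i i≤j with i ≤? m
  ... | yes i≤m = left a≤i i≤m
  ... | no i≰m = right (≤-trans k≤1+m (≰⇒> i≰m)) i≤j

  Run-mono : ∀ {A B a j} → A ⊆ B → Run A a j → Run B a j
  Run-mono A⊆B run a≤m m≤j = let (m<len , inA) = run a≤m m≤j in m<len , A⊆B inA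

  Box-mono : ∀ {a j a′ j′} → a′ ≤ a → j ≤ j′ → Box a j ⊆ Box a′ j′
  Box-mono a′≤a j≤j′ v∈ = let (a≤v , v≤j) = ∈Box⁻ v∈ in ∈Box⁺ (≤-trans a′≤a a≤v) (≤-trans v≤j j≤j′)

  ∣∩Box∣-mono : ∀ {A B a j a′ j′} → A ⊆ B → a′ ≤ a → j ≤ j′ → ∣ A ∩ Box a j ∣ ≤ ∣ B ∩ Box a′ j′ ∣
  ∣∩Box∣-mono A⊆B a′≤a j≤j′ = p⊆q⇒∣p∣≤∣q∣ (∩-mono A⊆B (Box-mono a′≤a j≤j′))

  RunBounded-anti : ∀ {A B} → A ⊆ B → RunBounded B → RunBounded A
  RunBounded-anti A⊆B bounded a≤j run = ≤-trans (∣∩Box∣-mono A⊆B ≤-refl ≤-refl) (bounded a≤j (Run-mono A⊆B run))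

  Heavy : Subset n → ℕ → ℕ → Set
  Heavy A a j = Run A a j × r < ∣ A ∩ Box a j ∣

  heavy? : ∀ A a j → Dec (Heavy A a j)
  heavy? A a j = run? A a j ×-dec r <? ∣ A ∩ Box a j ∣

  record Violation (A : Subset n) : Set where
    field
      start end     : ℕ
      start≤end     : start ≤ end
      heavy         : Heavy A start end
      prefix-light  : ∀ {j} → start ≤ j → j < end → ∣ A ∩ Box start j ∣ ≤ r
      start-maximal : ∀ {m} → m < start → ¬ Run A m end

  classify : ∀ A → RunBounded A ⊎ Violation A
  classify A with least< (λ j → anyUpTo? (λ a → heavy? A a j) (suc j)) len
  ... | inj₁ none = inj₁ λ {a} {j} a≤j run →
          ≮⇒≥ λ over → none (proj₁ (run a≤j ≤-refl)) (a , s≤s a≤j , run , over)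
  ... | inj₂ (j , _ , (a₀ , a₀≤j , heavy₀) , earlier) with least< (λ a → heavy? A a j) (suc j)
  ...   | inj₁ none = ⊥-elim (none a₀≤j heavy₀)
  ...   | inj₂ (a , s≤s a≤j , heavy@(run , over) , smaller) = inj₂ record
    { start = a ; end = j ; start≤end = a≤j ; heavy = heavy
    ; prefix-light = λ a≤j′ j′<j → ≮⇒≥ λ over′ →
        earlier j′<j (a , s≤s a≤j′ , (λ a≤m m≤j′ → run a≤m (≤-trans m≤j′ (<⇒≤ j′<j))) , over′)
    ; start-maximal = λ m<a run′ → smaller m<a (run′ , <-≤-trans over (∣∩Box∣-mono {A} ⊆-refl (<⇒≤ m<a) ≤-refl))
    }

  RunBounded⇒¬Violation : ∀ {A} → RunBounded A → ¬ Violation A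
  RunBounded⇒¬Violation bounded vi = <⇒≱ over (bounded start≤end run)
    where open Violation vi
          run = proj₁ heavy
          over = proj₂ heavy

  runBounded? : ∀ A → Dec (RunBounded A)
  runBounded? A with classify A
  ... | inj₁ bounded = yes bounded
  ... | inj₂ vi = no λ bounded → RunBounded⇒¬Violation bounded vi

  OnSpine : Fin n → Set
  OnSpine v = spine (pos v) ≡ v

  onSpine∈⇒SpineIn : ∀ {A v} → OnSpine v → v ∈ A → SpineIn A (pos v)
  onSpine∈⇒SpineIn {A} onSpine v∈A = pos<len _ , subst (_∈ A) (sym onSpine) v∈A

  adj-pos : ∀ {u w} → Adj G u w →
            pos u ≡ pos w ⊎ (OnSpine u × OnSpine w × (suc (pos u) ≡ pos w ⊎ suc (pos w) ≡ pos u))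
  adj-pos {u} {w} u~w with spine (pos u) ≟ u | spine (pos w) ≟ w
  ... | no leaf | _ = inj₁ (trans (sym (pos-spine (pos<len u))) (cong pos (sym (leaf-adj leaf u~w))))
  ... | yes _ | no leaf = inj₁ (trans (cong pos (leaf-adj leaf (symm G u~w))) (pos-spine (pos<len w)))
  ... | yes onSpine-u | yes onSpine-w = inj₂ (onSpine-u , onSpine-w , spine-adj onSpine-u onSpine-w u~w)

  MaximalRun : Subset n → ℕ → ℕ → Set
  MaximalRun A a b = Run A a b × (∀ {m} → suc m ≡ a → ¬ SpineIn A m) × ¬ SpineIn A (suc b)

  maximal-run : ∀ {A m} → SpineIn A m → ∃[ a ] ∃[ b ] (a ≤ m × m ≤ b × MaximalRun A a b)
  maximal-run {A} {m} inA with least< (λ a → run? A a m) (suc m) | greatest< (λ b → run? A m b) len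
  ... | inj₁ none | _ = ⊥-elim (none ≤-refl (Run-single inA))
  ... | _ | inj₁ none = ⊥-elim (none (proj₁ inA) (Run-single inA))
  ... | inj₂ (a , s≤s a≤m , runˡ , smaller) | inj₂ (b , _ , runʳ , larger) =
    a , b , a≤m , m≤b , Run-join (n≤1+n m) runˡ runʳ
      , (λ { refl inA′ → smaller ≤-refl (Run-join ≤-refl (Run-single inA′) runˡ) })
      , λ inA′ → larger ≤-refl (proj₁ inA′) (Run-join ≤-refl runʳ (Run-single inA′))
    where
    m≤b : m ≤ b
    m≤b = ≮⇒≥ λ b<m → larger b<m (proj₁ inA) (Run-single inA)

  MaximalRun-closed : ∀ {A a b u w} → MaximalRun A a b → u ∈ A → u ∈ Box a b → Adj G u w → w ∈ A → w ∈ Box a b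
  MaximalRun-closed {A} {a} {b} {u} {w} (_ , left-end , right-end) u∈A u∈Box u~w w∈A
    with ∈Box⁻ u∈Box | adj-pos u~w
  ... | a≤u , u≤b | inj₁ same = ∈Box⁺ (subst (a ≤_) same a≤u) (subst (_≤ b) same u≤b)
  ... | a≤u , u≤b | inj₂ (_ , onSpine-w , inj₁ next) = ∈Box⁺ (≤-trans a≤u (subst (pos u ≤_) next (n≤1+n _))) w≤b
    where
    w≤b : pos w ≤ b
    w≤b = ≮⇒≥ λ b<w → right-end (subst (SpineIn A) (≤-antisym (subst (_≤ suc b) next (s≤s u≤b)) b<w)
                                          (onSpine∈⇒SpineIn onSpine-w w∈A))
  ... | a≤u , u≤b | inj₂ (_ , onSpine-w , inj₂ prev) = ∈Box⁺ a≤w (≤-trans (subst (pos w ≤_) prev (n≤1+n _)) u≤b)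
    where
    a≤w : a ≤ pos w
    a≤w = ≮⇒≥ λ w<a → left-end (≤-antisym w<a (subst (a ≤_) (sym prev) a≤u)) (onSpine∈⇒SpineIn onSpine-w w∈A)

  spine-walk : ∀ {A a j} → Run A a j → ∀ {m} → a ≤ m → m ≤ j → Walk G (_∈ A) (spine a) (spine m)
  spine-walk run {zero} z≤n 0≤j = here (proj₂ (run z≤n 0≤j))
  spine-walk {A} {a} run {suc m} a≤1+m 1+m≤j with a ≤? m
  ... | yes a≤m = walk-snoc (spine-walk run a≤m (≤-trans (n≤1+n m) 1+m≤j))
                            (adj-next (proj₁ (run a≤1+m 1+m≤j))) (proj₂ (run a≤1+m 1+m≤j))
  ... | no a≰m = subst (λ k → Walk G (_∈ A) (spine a) (spine k)) (≤-antisym a≤1+m (≰⇒> a≰m))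
                       (here (proj₂ (run ≤-refl (≤-trans a≤1+m 1+m≤j))))

  Ind⇒RunBounded : ∀ {A} → Ind r G A → RunBounded A
  Ind⇒RunBounded {A} independent {a} {j} a≤j run with enumerate (A ∩ Box a j)
  ... | ys , unique , ys⊆ , length≡ =
    subst (_≤ r) length≡ (independent (spine a) (proj₂ (run ≤-refl a≤j)) ys unique (All.map reach ys⊆))
    where
    reach : ∀ {y} → y ∈ A ∩ Box a j → Walk G (_∈ A) (spine a) y
    reach {y} y∈ with x∈p∩q⁻ A (Box a j) y∈
    ... | y∈A , y∈Box with ∈Box⁻ y∈Box | spine (pos y) ≟ y
    ...   | a≤y , y≤j | yes onSpine = subst (Walk G (_∈ A) (spine a)) onSpine (spine-walk run a≤y y≤j)
    ...   | a≤y , y≤j | no leaf = walk-snoc (spine-walk run a≤y y≤j) (symm G (adj-foot leaf)) y∈A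

  RunBounded⇒Ind : 1 ≤ r → ∀ {A} → RunBounded A → Ind r G A
  RunBounded⇒Ind 1≤r {A} bounded z z∈A ys unique walks with spineIn? A (pos z)
  ... | no foot∉A = ≤-trans (unique⇒length≤∣p∣ unique (All.map stuck walks)) (subst (_≤ r) (sym (∣⁅x⁆∣≡1 z)) 1≤r)
    where
    stuck : ∀ {y} → Walk G (_∈ A) z y → y ∈ ⁅ z ⁆
    stuck walk = subst (_∈ ⁅ z ⁆) (sym (walk-invariant (_≡ z) step walk refl)) (x∈⁅x⁆ z)
      where
      step : ∀ {u w} → u ∈ A → u ≡ z → Adj G u w → w ∈ A → w ≡ z
      step u∈A refl u~w w∈A = ⊥-elim (foot∉A (pos<len z , subst (_∈ A) (leaf-adj leaf u~w) w∈A))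
        where leaf = λ onSpine → foot∉A (onSpine∈⇒SpineIn onSpine z∈A)
  ... | yes foot∈A with maximal-run foot∈A
  ...   | a , b , a≤z , z≤b , maximal@(run , _) =
    ≤-trans (unique⇒length≤∣p∣ unique (All.map inBox walks)) (bounded (≤-trans a≤z z≤b) run)
    where
    inBox : ∀ {y} → Walk G (_∈ A) z y → y ∈ A ∩ Box a b
    inBox walk = x∈p∩q⁺ (walk-end walk , walk-invariant (_∈ Box a b) (MaximalRun-closed maximal) walk (∈Box⁺ a≤z z≤b))

-- Shedding vertices

module SpineShedding {n : ℕ} {G : Graph n} (S : Spine G) (r : ℕ) where
  open Spine S
  open SpineRuns S r
  open import Algebra.Properties.CommutativeSemigroup (CommutativeMonoid.commutativeSemigroup (∪-commutativeMonoid n))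
    using (xy∙z≈xz∙y; xy∙z≈x∙zy)

  Run-∪⁅⁆⁻ : ∀ {A w a j} → (∀ {m} → a ≤ m → m ≤ j → spine m ≢ w) → Run (A ∪ ⁅ w ⁆) a j → Run A a j
  Run-∪⁅⁆⁻ {A} avoids run a≤m m≤j with run a≤m m≤j
  ... | m<len , inA∪w with x∈p∪⁅y⁆⁻ A inA∪w
  ...   | inj₁ inA = m<len , inA
  ...   | inj₂ ≡w = ⊥-elim (avoids a≤m m≤j ≡w)

  Run-hull : ∀ {A a j p q c} → a ≤ c → c ≤ j → p ≤ c → c ≤ q →
             Run A a j → Run A p q → Run A (a ⊓ p) (j ⊔ q)
  Run-hull {a = a} {j} {p} {q} a≤c c≤j p≤c c≤q run₁ run₂ {m} lo hi with a ≤? m | m ≤? j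
  ... | yes a≤m | yes m≤j = run₁ a≤m m≤j
  ... | no a≰m | _ = run₂ (≮⇒≥ λ m<p → <⇒≱ (⊓-glb (≰⇒> a≰m) m<p) lo) (≤-trans (<⇒≤ (≰⇒> a≰m)) (≤-trans a≤c c≤q))
  ... | yes _ | no m≰j = run₂ (≤-trans p≤c (≤-trans c≤j (<⇒≤ (≰⇒> m≰j)))) (≮⇒≥ λ q<m → <⇒≱ (⊔-lub (≰⇒> m≰j) q<m) hi)

  cone : ∀ {A w} → RunBounded A →
         (∀ {a j} → a ≤ j → Run (A ∪ ⁅ w ⁆) a j → w ∈ Box a j → ∣ (A ∪ ⁅ w ⁆) ∩ Box a j ∣ ≤ r) →
         RunBounded (A ∪ ⁅ w ⁆)
  cone {A} {w} boundedA through-w {a} {j} a≤j run with w ∈? Box a j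
  ... | yes w∈Box = through-w a≤j run w∈Box
  ... | no w∉Box = ≤-trans (p⊆q⇒∣p∣≤∣q∣ sub) (boundedA a≤j (Run-∪⁅⁆⁻ avoids run))
    where
    avoids : ∀ {m} → a ≤ m → m ≤ j → spine m ≢ w
    avoids a≤m m≤j refl = w∉Box (spine∈Box (proj₁ (run a≤m m≤j)) a≤m m≤j)
    sub : (A ∪ ⁅ w ⁆) ∩ Box a j ⊆ A ∩ Box a j
    sub v∈ with x∈p∩q⁻ (A ∪ ⁅ w ⁆) (Box a j) v∈
    ... | v∈A∪w , v∈Box with x∈p∪⁅y⁆⁻ A v∈A∪w
    ...   | inj₁ v∈A = x∈p∩q⁺ (v∈A , v∈Box)
    ...   | inj₂ refl = ⊥-elim (w∉Box v∈Box)

  -- Every run through the leaf w, widened to cover [p, q], is a run of A ∪ ⁅ x ⁆ counting x instead of w.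
  replace-by-leaf : ∀ {A x w p q} → ¬ OnSpine w → w ∉ A → x ∉ A → w ∈ Box p q → x ∈ Box p q →
                    Run (A ∪ ⁅ x ⁆) p q → RunBounded (A ∪ ⁅ x ⁆) → RunBounded (A ∪ ⁅ w ⁆)
  replace-by-leaf {A} {x} {w} {p} {q} leaf w∉A x∉A w∈Boxpq x∈Boxpq runpq bounded =
    cone (RunBounded-anti (p⊆p∪q _) bounded) λ {a} {j} a≤j run w∈Box →
      let (a≤w , w≤j) = ∈Box⁻ w∈Box
          (p≤w , w≤q) = ∈Box⁻ w∈Boxpq
          (p≤x , x≤q) = ∈Box⁻ x∈Boxpq
          runA : Run A a j
          runA = Run-∪⁅⁆⁻ (λ { a≤m m≤j refl → leaf (cong spine (pos-spine (proj₁ (run a≤m m≤j)))) }) run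
      in begin
        ∣ (A ∪ ⁅ w ⁆) ∩ Box a j ∣            ≤⟨ ∣p∪⁅x⁆∩q∣≤1+∣p∩q∣ A (Box a j) w ⟩
        suc ∣ A ∩ Box a j ∣                   ≤⟨ s≤s (∣∩Box∣-mono {A} ⊆-refl (m⊓n≤m a p) (m≤m⊔n j q)) ⟩
        suc ∣ A ∩ Box (a ⊓ p) (j ⊔ q) ∣       ≤⟨ x∉p∧x∈q⇒∣p∩q∣<∣p∪⁅x⁆∩q∣ x∉A (∈Box⁺ (≤-trans (m⊓n≤n a p) p≤x) (≤-trans x≤q (m≤n⊔m j q))) ⟩
        ∣ (A ∪ ⁅ x ⁆) ∩ Box (a ⊓ p) (j ⊔ q) ∣ ≤⟨ bounded (≤-trans (m⊓n≤m a p) (≤-trans a≤j (m≤m⊔n j q)))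
                                                   (Run-hull a≤w w≤j p≤w w≤q (Run-mono (p⊆p∪q _) runA) runpq) ⟩
        r                                     ∎
    where open ≤-Reasoning

  Restricted : Subset n → Subset n → Complex n
  Restricted T V F = F ⊆ V × RunBounded (F ∪ T)

  Disjoint : Subset n → Subset n → Set
  Disjoint T V = ∀ {v} → v ∈ V → v ∉ T

  module Shedding {T V : Subset n} (disjoint : Disjoint T V) (vi : Violation (T ∪ V)) where
    open Violation vi

    Exchange : Fin n → Set
    Exchange x = ∀ {A v} → T ⊆ A → A ⊆ T ∪ V → x ∉ A → v ∉ A → v ≢ x → v ∈ V → v ∈ Box start end →
                 RunBounded (A ∪ ⁅ x ⁆) → RunBounded (A ∪ ⁅ v ⁆)

    exchange⇒shedding : ∀ {x} → x ∈ V → Exchange x →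
                        ∀ F → IsFacet (del (Restricted T V) x) F → IsFacet (Restricted T V) F
    exchange⇒shedding {x} x∈V exchange F ((x∉F , F⊆V , boundedF) , maximal) = (F⊆V , boundedF) , extend
      where
      F∪T⊆T∪V : F ∪ T ⊆ T ∪ V
      F∪T⊆T∪V = ∪-lub (q⊆p∪q T V ∘ F⊆V) (p⊆p∪q V)

      extend : ∀ G → Restricted T V G → F ⊆ G → G ⊆ F
      extend G (G⊆V , boundedG) F⊆G with x ∈? G
      ... | no x∉G = maximal G (x∉G , G⊆V , boundedG) F⊆G
      ... | yes x∈G = ⊥-elim (<⇒≱ (proj₂ heavy) (≤-trans (p⊆q⇒∣p∣≤∣q∣ covers∩) (boundedB start≤end runB)))
        where
        B = (F ∪ T) ∪ ⁅ x ⁆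
        boundedB : RunBounded B
        boundedB = RunBounded-anti (∪-lub (∪-lub (p⊆p∪q T ∘ F⊆G) (q⊆p∪q G T)) (⁅x⁆⊆p (p⊆p∪q T x∈G))) boundedG

        covers : ∀ {v} → v ∈ T ∪ V → v ∈ Box start end → v ∈ B
        covers {v} v∈U v∈Box with x∈p∪q⁻ T V v∈U
        ... | inj₁ v∈T = p⊆p∪q _ (q⊆p∪q F T v∈T)
        ... | inj₂ v∈V with v ≟ x | v ∈? F
        ...   | yes refl | _ = q⊆p∪q _ _ (x∈⁅x⁆ x)
        ...   | no _ | yes v∈F = p⊆p∪q _ (p⊆p∪q T v∈F)
        ...   | no v≢x | no v∉F = ⊥-elim (v∉F (maximal (F ∪ ⁅ v ⁆) face (p⊆p∪q _) (q⊆p∪q F _ (x∈⁅x⁆ v))))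
          where
          face : del (Restricted T V) x (F ∪ ⁅ v ⁆)
          face = x∉p∪q x∉F (x≢y⇒x∉⁅y⁆ (v≢x ∘ sym))
               , ∪-lub F⊆V (⁅x⁆⊆p v∈V)
               , subst RunBounded (sym (xy∙z≈xz∙y F ⁅ v ⁆ T))
                   (exchange (q⊆p∪q F T) F∪T⊆T∪V (x∉p∪q x∉F (disjoint x∈V)) (x∉p∪q v∉F (disjoint v∈V))
                             v≢x v∈V v∈Box boundedB)

        covers∩ : (T ∪ V) ∩ Box start end ⊆ B ∩ Box start end
        covers∩ v∈ = let (v∈U , v∈Box) = x∈p∩q⁻ (T ∪ V) (Box start end) v∈ in x∈p∩q⁺ (covers v∈U v∈Box , v∈Box)

        runB : Run B start end
        runB a≤m m≤j = let (m<len , inU) = proj₁ heavy a≤m m≤j in m<len , covers inU (spine∈Box m<len a≤m m≤j)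

    spine∈T : ∀ {m} → start ≤ m → m ≤ end → spine m ∉ V → spine m ∈ T
    spine∈T a≤m m≤j ∉V with x∈p∪q⁻ T V (proj₂ (proj₁ heavy a≤m m≤j))
    ... | inj₁ ∈T = ∈T
    ... | inj₂ ∈V = ⊥-elim (∉V ∈V)

    exchange-last : ∀ {i} → start ≤ i → i ≤ end → spine i ∈ V →
                    (∀ {k} → i < k → k < suc end → ¬ (start ≤ k × spine k ∈ V)) → Exchange (spine i)
    exchange-last {i} a≤i i≤j xi∈V later {A} {v} T⊆A A⊆U x∉A v∉A v≢x v∈V v∈Box boundedAx with pos v ≤? i
    ... | yes v≤i = cone (RunBounded-anti (p⊆p∪q _) boundedAx) through-v
      where
      A∪v⊆U : A ∪ ⁅ v ⁆ ⊆ T ∪ V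
      A∪v⊆U = ∪-lub A⊆U (⁅x⁆⊆p (q⊆p∪q T V v∈V))

      through-v : ∀ {a′ j′} → a′ ≤ j′ → Run (A ∪ ⁅ v ⁆) a′ j′ → v ∈ Box a′ j′ → ∣ (A ∪ ⁅ v ⁆) ∩ Box a′ j′ ∣ ≤ r
      through-v {a′} {j′} a′≤j′ run′ v∈Box′ =
        ≤-trans (∣∩Box∣-mono A∪v⊆U a≤a′ ≤-refl) (prefix-light (≤-trans a≤a′ a′≤j′) (<-≤-trans j′<i i≤j))
        where
        a≤a′ : start ≤ a′
        a≤a′ = ≮⇒≥ λ a′<a → start-maximal a′<a
                 (Run-join (≤-trans (proj₁ (∈Box⁻ v∈Box)) (≤-trans (proj₂ (∈Box⁻ v∈Box′)) (n≤1+n j′)))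
                           (Run-mono A∪v⊆U run′) (proj₁ heavy))
        j′<i : j′ < i
        j′<i = ≰⇒> λ i≤j′ → [ x∉A , v≢x ∘ sym ]′ (x∈p∪⁅y⁆⁻ A (proj₂ (run′ (≤-trans (proj₁ (∈Box⁻ v∈Box′)) v≤i) i≤j′)))
    ... | no v≰i = replace-by-leaf leaf v∉A x∉A (∈Box⁺ (<⇒≤ i<v) ≤-refl) (spine∈Box i<len ≤-refl (<⇒≤ i<v)) runAx boundedAx
      where
      i<v = ≰⇒> v≰i
      a≤v = proj₁ (∈Box⁻ v∈Box)
      v≤j = proj₂ (∈Box⁻ v∈Box)
      i<len = proj₁ (proj₁ heavy a≤i i≤j)

      leaf : ¬ OnSpine v
      leaf onSpine = later i<v (s≤s v≤j) (a≤v , subst (_∈ V) (sym onSpine) v∈V)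

      runAx : Run (A ∪ ⁅ spine i ⁆) i (pos v)
      runAx {m} i≤m m≤v with m≤n⇒m<n∨m≡n i≤m
      ... | inj₂ refl = i<len , q⊆p∪q A _ (x∈⁅x⁆ (spine i))
      ... | inj₁ i<m = proj₁ (proj₁ heavy a≤m m≤j)
                     , p⊆p∪q _ (T⊆A (spine∈T a≤m m≤j λ ∈V → later i<m (s≤s m≤j) (a≤m , ∈V)))
        where
        a≤m = ≤-trans a≤i i≤m
        m≤j = ≤-trans m≤v v≤j

    exchange-leaf : (∀ {m} → m < suc end → ¬ (start ≤ m × spine m ∈ V)) →
                    ∀ {x} → x ∈ Box start end → Exchange x
    exchange-leaf none {x} x∈Box {A} {v} T⊆A A⊆U x∉A v∉A v≢x v∈V v∈Box boundedAx =
      replace-by-leaf leaf v∉A x∉A (∈Box⁺ (m⊓n≤m _ _) (m≤m⊔n _ _)) (∈Box⁺ (m⊓n≤n _ _) (m≤n⊔m _ _)) runAx boundedAx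
      where
      a≤v = proj₁ (∈Box⁻ v∈Box)
      v≤j = proj₂ (∈Box⁻ v∈Box)
      a≤x = proj₁ (∈Box⁻ x∈Box)
      x≤j = proj₂ (∈Box⁻ x∈Box)

      leaf : ¬ OnSpine v
      leaf onSpine = none (s≤s v≤j) (a≤v , subst (_∈ V) (sym onSpine) v∈V)

      runAx : Run (A ∪ ⁅ x ⁆) (pos v ⊓ pos x) (pos v ⊔ pos x)
      runAx lo hi = proj₁ (proj₁ heavy a≤m m≤j) , p⊆p∪q _ (T⊆A (spine∈T a≤m m≤j λ ∈V → none (s≤s m≤j) (a≤m , ∈V)))
        where
        a≤m = ≤-trans (⊓-glb a≤v a≤x) lo
        m≤j = ≤-trans hi (⊔-lub v≤j x≤j)

    shedding-vertex : RunBounded T → ∃[ x ] (x ∈ V × Exchange x)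
    shedding-vertex boundedT with greatest< (λ i → start ≤? i ×-dec spine i ∈? V) (suc end)
    ... | inj₂ (i , s≤s i≤j , (a≤i , xi∈V) , later) = spine i , xi∈V , exchange-last a≤i i≤j xi∈V later
    ... | inj₁ none with nonempty? (V ∩ Box start end)
    ...   | yes (x , x∈) = let (x∈V , x∈Box) = x∈p∩q⁻ V (Box start end) x∈ in x , x∈V , exchange-leaf none x∈Box
    ...   | no empty = ⊥-elim (<⇒≱ (proj₂ heavy) (≤-trans (p⊆q⇒∣p∣≤∣q∣ inT) (boundedT start≤end runT)))
      where
      inT : (T ∪ V) ∩ Box start end ⊆ T ∩ Box start end
      inT v∈ with x∈p∩q⁻ (T ∪ V) (Box start end) v∈
      ... | v∈U , v∈Box with x∈p∪q⁻ T V v∈U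
      ...   | inj₁ v∈T = x∈p∩q⁺ (v∈T , v∈Box)
      ...   | inj₂ v∈V = ⊥-elim (empty (_ , x∈p∩q⁺ (v∈V , v∈Box)))
      runT : Run T start end
      runT a≤m m≤j = proj₁ (proj₁ heavy a≤m m≤j) , spine∈T a≤m m≤j λ ∈V → none (s≤s m≤j) (a≤m , ∈V)

  open Shedding using (shedding-vertex; exchange⇒shedding)

  Disjoint-minus : ∀ {T V x} → Disjoint T V → Disjoint T (V - x)
  Disjoint-minus disjoint = disjoint ∘ proj₁ (⊆-minus⁻ ⊆-refl)

  shed-Restricted : ∀ {T V x} → x ∈ V → Disjoint T V →
                    (∀ F → IsFacet (del (Restricted T V) x) F → IsFacet (Restricted T V) F) →
                    (∀ {T′} → Disjoint T′ (V - x) → RunBounded T′ → VertexDecomposable (Restricted T′ (V - x))) →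
                    RunBounded T → VertexDecomposable (Restricted T V)
  shed-Restricted {T} {V} {x} x∈V disjoint sheds recurse boundedT with runBounded? (⁅ x ⁆ ∪ T)
  ... | no x-heavy = VertexDecomposable-resp without-x (recurse (Disjoint-minus disjoint) boundedT)
    where
    without-x : Restricted T (V - x) ≐ Restricted T V
    without-x = (λ (F⊆V-x , bounded) → proj₁ (⊆-minus⁻ F⊆V-x) , bounded)
              , λ (F⊆V , bounded) → ⊆-minus⁺ F⊆V (λ x∈F → x-heavy (RunBounded-anti (∪-lub (⁅x⁆⊆p (p⊆p∪q T x∈F)) (q⊆p∪q _ T)) bounded)) , bounded
  ... | yes x-light = shed x (⁅x⁆⊆p x∈V , x-light) (VertexDecomposable-resp link (recurse disjoint-link boundedT∪x))
                             (VertexDecomposable-resp deletion (recurse (Disjoint-minus disjoint) boundedT)) sheds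
    where
    disjoint-link : Disjoint (T ∪ ⁅ x ⁆) (V - x)
    disjoint-link v∈ = x∉p∪q (Disjoint-minus disjoint v∈) (x≢y⇒x∉⁅y⁆ λ { refl → proj₂ (⊆-minus⁻ ⊆-refl) v∈ })
    boundedT∪x : RunBounded (T ∪ ⁅ x ⁆)
    boundedT∪x = subst RunBounded (∪-comm ⁅ x ⁆ T) x-light
    link : Restricted (T ∪ ⁅ x ⁆) (V - x) ≐ lk (Restricted T V) x
    link = (λ (F⊆V-x , bounded) → let (F⊆V , x∉F) = ⊆-minus⁻ F⊆V-x in
                                   x∉F , ∪-lub F⊆V (⁅x⁆⊆p x∈V) , subst RunBounded (sym (xy∙z≈x∙zy _ ⁅ x ⁆ T)) bounded)
         , λ (x∉F , F∪x⊆V , bounded) → ⊆-minus⁺ (F∪x⊆V ∘ p⊆p∪q _) x∉F , subst RunBounded (xy∙z≈x∙zy _ ⁅ x ⁆ T) bounded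
    deletion : Restricted T (V - x) ≐ del (Restricted T V) x
    deletion = (λ (F⊆V-x , bounded) → let (F⊆V , x∉F) = ⊆-minus⁻ F⊆V-x in x∉F , F⊆V , bounded)
             , λ (x∉F , F⊆V , bounded) → ⊆-minus⁺ F⊆V x∉F , bounded

  Restricted-vertexDecomposable : ∀ {V} → Acc _<_ ∣ V ∣ → ∀ {T} → Disjoint T V → RunBounded T → VertexDecomposable (Restricted T V)
  Restricted-vertexDecomposable {V} (acc smaller) {T} disjoint boundedT with classify (T ∪ V)
  ... | inj₁ boundedU = simplex (V , λ F → proj₁ , λ F⊆V → F⊆V , RunBounded-anti (∪-lub (q⊆p∪q T V ∘ F⊆V) (p⊆p∪q V)) boundedU)
  ... | inj₂ vi = let (x , x∈V , exchange) = shedding-vertex disjoint vi boundedT in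
    shed-Restricted x∈V disjoint (exchange⇒shedding disjoint vi x∈V exchange)
                    (Restricted-vertexDecomposable (smaller (x∈p⇒∣p-x∣<∣p∣ x∈V))) boundedT

  RunBounded-∅ : RunBounded ∅
  RunBounded-∅ a≤j run = ⊥-elim (∉⊥ (proj₂ (run ≤-refl a≤j)))

  Restricted≐Ind : 1 ≤ r → Restricted ∅ full ≐ Ind r G
  Restricted≐Ind 1≤r = (λ {F} (_ , bounded) → RunBounded⇒Ind 1≤r (subst RunBounded (∪-identityʳ F) bounded))
                     , λ {F} independent → ⊆⊤ , subst RunBounded (sym (∪-identityʳ F)) (Ind⇒RunBounded independent)

  Ind-vertexDecomposable : 1 ≤ r → VertexDecomposable (Ind r G)
  Ind-vertexDecomposable 1≤r = VertexDecomposable-resp (Restricted≐Ind 1≤r)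
    (Restricted-vertexDecomposable {full} (<-wellFounded _) (λ _ → ∉⊥) RunBounded-∅)

theorem3p12 : (n : ℕ) (CG : Graph n) → IsCaterpillar CG →
    (r : ℕ) → r ≥ 1 → VertexDecomposable (Ind r CG)
theorem3p12 zero CG _ r _ = simplex ([] , λ _ → (λ { _ {()} _ }) , λ _ ())
theorem3p12 (suc n) CG caterpillar r r≥1 =
  SpineShedding.Ind-vertexDecomposable (caterpillar-spine zero caterpillar) r r≥1
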